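{- Let $r\ge2$ and $n_1,\dots,n_r$ be positive integers. Then $\mu_{\mathrm{int}}(K_{n_1,n_2,\dots,n_r})\le\left\lceil\frac{r}{2}\right\rceil$.
   Context: Graphs are finite and simple. $K_{n_1,\dots,n_r}$ is the complete $r$-partite graph whose vertex set is partitioned into independent sets $V_1,\dots,V_r$ with $|V_i|=n_i$, every vertex of $V_i$ being adjacent to every vertex of $V_j$ for $i\ne j$. A $k$-improper edge coloring of $G$ is a map $\alpha:E(G)\to\mathbb{N}$ such that at most $k$ edges with a common endpoint receive the same color; it is an improper interval coloring if at every vertex the colors on incident edges form a set of consecutive integers. $\mu_{\mathrm{int}}(G)$ is the smallest $k$ such that $G$ has a $k$-improper interval edge coloring. -}

module Defs where

open import Data.Nat using (ℕ; zero; suc; _+_; _≤_; _≟_)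
open import Data.Fin using (Fin)
import Data.Fin as Fin
open import Data.Product using (Σ; ∃-syntax; _×_; _,_; proj₁)
open import Relation.Nullary using (¬_; Dec; yes; no)
open import Relation.Nullary.Decidable using (_×-dec_; ¬?)
open import Relation.Binary.PropositionalEquality using (_≡_)
open import Data.Fin.Properties using () renaming (_≟_ to _≟ᶠ_)

count : (m : ℕ) {P : Fin m → Set} → (∀ i → Dec (P i)) → ℕ
count zero    P? = 0
count (suc m) P? with P? Fin.zero
... | yes _ = suc (count m (λ i → P? (Fin.suc i)))
... | no  _ = count m (λ i → P? (Fin.suc i))

sumFin : (m : ℕ) → (Fin m → ℕ) → ℕ
sumFin zero    f = 0
sumFin (suc m) f = f Fin.zero + sumFin m (λ i → f (Fin.suc i))

-- The complete r-partite graph K_{n_1,...,n_r} (parts indexed by Fin r,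
-- |V_i| = n i): vertices are pairs (i , a) with a : Fin (n i); two
-- vertices are adjacent iff they lie in different parts.

Vtx : (r : ℕ) → (Fin r → ℕ) → Set
Vtx r n = Σ (Fin r) λ i → Fin (n i)

Adj : (r : ℕ) (n : Fin r → ℕ) → Vtx r n → Vtx r n → Set
Adj r n u v = ¬ (proj₁ u ≡ proj₁ v)

adj? : (r : ℕ) (n : Fin r → ℕ) → ∀ u v → Dec (Adj r n u v)
adj? r n u v = ¬? (proj₁ u ≟ᶠ proj₁ v)

-- Edge colourings with colours in ℕ: a function on ordered pairs of
-- vertices that is symmetric on edges (hence a function of the edge
-- {u,v}); values on non-adjacent pairs are irrelevant.

record EdgeColoring (r : ℕ) (n : Fin r → ℕ) : Set where
  field
    col     : Vtx r n → Vtx r n → ℕ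
    col-sym : ∀ {u v} → Adj r n u v → col u v ≡ col v u

open EdgeColoring public

edgesWithColor : (r : ℕ) (n : Fin r → ℕ) → EdgeColoring r n → Vtx r n → ℕ → ℕ
edgesWithColor r n α v x =
  sumFin r λ j → count (n j) λ b →
    adj? r n v (j , b) ×-dec (col α v (j , b) ≟ x)

IsKImproper : (r : ℕ) (n : Fin r → ℕ) → ℕ → EdgeColoring r n → Set
IsKImproper r n k α = ∀ v x → edgesWithColor r n α v x ≤ k

ColorAt : (r : ℕ) (n : Fin r → ℕ) → EdgeColoring r n → Vtx r n → ℕ → Set
ColorAt r n α v x = ∃[ u ] (Adj r n v u × col α v u ≡ x)

IsInterval : (r : ℕ) (n : Fin r → ℕ) → EdgeColoring r n → Set
IsInterval r n α = ∀ v a b x → ColorAt r n α v a → ColorAt r n α v b →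
  a ≤ x → x ≤ b → ColorAt r n α v x

HasKImproperIntervalColoring : (r : ℕ) (n : Fin r → ℕ) → ℕ → Set
HasKImproperIntervalColoring r n k =
  Σ (EdgeColoring r n) λ α → IsKImproper r n k α × IsInterval r n α

-- μ_int(K_{n_1,...,n_r}) ≤ m : the least k admitting a k-improper interval
-- colouring is at most m, i.e. some k ≤ m admits one.
μint≤ : (r : ℕ) (n : Fin r → ℕ) → ℕ → Set
μint≤ r n m = ∃[ k ] (k ≤ m × HasKImproperIntervalColoring r n k)

-- Pair up the parts as {V₁,V₂}, {V₃,V₄}, …, giving ⌈r/2⌉ groups.  Inside a
-- group, the edge between the a-th vertex of one part and the b-th vertex of
-- the other gets colour a + b.  Each group is also laid out as one block
-- (its first part followed by its second), and an edge between different
-- groups gets the sum of the block positions of its ends.  At a fixed vertex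
-- the colours towards one group are pairwise distinct, so each colour is used
-- at most once per group; and the colours at the a-th vertex of a part fill
-- the interval starting at a: its own group contributes a + [0, n'), where n'
-- is the size of its partner part, and the block position of the vertex is
-- a or a + n' according as the vertex lies in the first or the second part.
module Submission where

open import Defs
open import Data.Nat using (ℕ; _≤_; _<_; ⌈_/2⌉)
open import Data.Fin using (Fin)
open import Data.Bool using (Bool; true; false)
open import Data.Bool.Properties using (¬-not) renaming (_≟_ to _≟ᵇ_)
open import Data.Nat using (zero; suc; _+_; _∸_; z≤n; s≤s; _≟_; _<?_)
open import Data.Nat.Properties hiding (suc-injective)
import Data.Nat.Properties as ℕₚ
open import Data.Fin using (zero; suc; toℕ; fromℕ<)
open import Data.Fin.Properties using (suc-injective; toℕ-injective; toℕ<n; toℕ-fromℕ<)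
open import Data.Product using (∃-syntax; _×_; _,_)
open import Data.Sum using (_⊎_; inj₁; inj₂)
open import Data.Empty using (⊥; ⊥-elim)
open import Function using (_∘_)
open import Relation.Nullary using (¬_; Dec; yes; no)
open import Relation.Nullary.Decidable using (_×-dec_)
open import Relation.Binary.PropositionalEquality

count-none : ∀ m {P : Fin m → Set} (P? : ∀ i → Dec (P i)) → (∀ i → ¬ P i) → count m P? ≡ 0
count-none zero    P? ¬P = refl
count-none (suc m) P? ¬P with P? zero
... | yes p = ⊥-elim (¬P zero p)
... | no  _ = count-none m (P? ∘ suc) (¬P ∘ suc)

count-≤1 : ∀ m {P : Fin m → Set} (P? : ∀ i → Dec (P i)) →
  (∀ {i j} → P i → P j → i ≡ j) → count m P? ≤ 1
count-≤1 zero    P? unique = z≤n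
count-≤1 (suc m) P? unique with P? zero
... | yes p = s≤s (≤-reflexive (count-none m (P? ∘ suc) λ i q → zero≢suc (unique p q)))
  where zero≢suc : ∀ {k} {i : Fin k} → ¬ zero ≡ suc i
        zero≢suc ()
... | no  _ = count-≤1 m (P? ∘ suc) λ p q → suc-injective (unique p q)

count-witness : ∀ m {P : Fin m → Set} (P? : ∀ i → Dec (P i)) → 0 < count m P? → ∃[ i ] P i
count-witness (suc m) P? pos with P? zero
... | yes p = zero , p
... | no  _ with count-witness m (P? ∘ suc) pos
...   | i , p = suc i , p

exclusive-+≤1 : ∀ {m n} → m ≤ 1 → n ≤ 1 → (0 < m → 0 < n → ⊥) → m + n ≤ 1
exclusive-+≤1 {zero}  m≤1 n≤1 excl = n≤1
exclusive-+≤1 {suc _} {zero}  m≤1 n≤1 excl = ≤-trans (≤-reflexive (+-identityʳ _)) m≤1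
exclusive-+≤1 {suc _} {suc _} m≤1 n≤1 excl = ⊥-elim (excl (s≤s z≤n) (s≤s z≤n))

suc₂ : ∀ {r} → Fin r → Fin (suc (suc r))
suc₂ i = suc (suc i)

group : ∀ {r} → Fin r → ℕ
group zero          = 0
group (suc zero)    = 0
group (suc (suc i)) = suc (group i)

second : ∀ {r} → Fin r → Bool
second zero          = false
second (suc zero)    = true
second (suc (suc i)) = second i

offset : ∀ {r} → (Fin r → ℕ) → Fin r → ℕ
offset n zero          = 0
offset n (suc zero)    = n zero
offset n (suc (suc i)) = offset (n ∘ suc₂) i

group-second-injective : ∀ {r} {i j : Fin r} → group i ≡ group j → second i ≡ second j → i ≡ j
group-second-injective {i = zero}          {zero}          _ _  = refl
group-second-injective {i = zero}          {suc zero}      _ ()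
group-second-injective {i = zero}          {suc (suc j)}   () _
group-second-injective {i = suc zero}      {zero}          _ ()
group-second-injective {i = suc zero}      {suc zero}      _ _  = refl
group-second-injective {i = suc zero}      {suc (suc j)}   () _
group-second-injective {i = suc (suc i)}   {zero}          () _
group-second-injective {i = suc (suc i)}   {suc zero}      () _
group-second-injective {i = suc (suc i)}   {suc (suc j)}   g  s =
  cong suc₂ (group-second-injective (ℕₚ.suc-injective g) s)

group-≤2 : ∀ {r} {i j k : Fin r} → j ≢ k → group j ≡ group k → group i ≡ group j → i ≡ j ⊎ i ≡ k
group-≤2 {i = i} {j} {k} j≢k gjk gij with second i ≟ᵇ second j
... | yes sij = inj₁ (group-second-injective gij sij)
... | no  sij = inj₂ (group-second-injective (trans gij gjk) (trans (¬-not sij) (sym (¬-not skj))))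
  where skj : second k ≢ second j
        skj s = j≢k (group-second-injective gjk (sym s))

offset-disjoint : ∀ {r} (n : Fin r → ℕ) {i j : Fin r} → i ≢ j → group i ≡ group j →
  ∀ {y z} → y < n i → z < n j → offset n i + y ≢ offset n j + z
offset-disjoint n {zero}        {zero}        i≢j _ _   _   _  = i≢j refl
offset-disjoint n {zero}        {suc zero}    _   _ y<n _   eq = <-irrefl eq (<-≤-trans y<n (m≤m+n _ _))
offset-disjoint n {suc zero}    {zero}        _   _ _   z<n eq = <-irrefl (sym eq) (<-≤-trans z<n (m≤m+n _ _))
offset-disjoint n {suc zero}    {suc zero}    i≢j _ _   _   _  = i≢j refl
offset-disjoint n {suc (suc i)} {suc (suc j)} i≢j g y<n z<n eq =
  offset-disjoint (n ∘ suc₂) (i≢j ∘ cong suc₂) (ℕₚ.suc-injective g) y<n z<n eq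
offset-disjoint n {zero}        {suc (suc j)} _ ()
offset-disjoint n {suc zero}    {suc (suc j)} _ ()
offset-disjoint n {suc (suc i)} {zero}        _ ()
offset-disjoint n {suc (suc i)} {suc zero}    _ ()

offset-cover : ∀ {r} (n : Fin r → ℕ) (j : Fin r) {y} → y < offset n j + n j →
  ∃[ k ] group k ≡ group j × offset n k ≤ y × y < offset n k + n k
offset-cover n zero          y<  = zero , refl , z≤n , y<
offset-cover n (suc zero) {y} y< with y <? n zero
... | yes y<n₀ = zero , refl , z≤n , y<n₀
... | no  y≮n₀ = suc zero , refl , ≮⇒≥ y≮n₀ , y<
offset-cover n (suc (suc j)) y< with offset-cover (n ∘ suc₂) j y<
... | k , g , o≤y , y<o = suc (suc k) , cong suc g , o≤y , y<o

below-offset-partner : ∀ {r} (n : Fin r → ℕ) (i : Fin r) {y} → y < offset n i →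
  ∃[ j ] j ≢ i × group j ≡ group i × y < n j
below-offset-partner n (suc zero)    y< = zero , (λ ()) , refl , y<
below-offset-partner n (suc (suc i)) y< with below-offset-partner (n ∘ suc₂) i y<
... | j , j≢i , g , y<n = suc (suc j) , j≢i ∘ suc-injective ∘ suc-injective , cong suc g , y<n

sumFin-≤-⌈/2⌉ : ∀ r (f : Fin r → ℕ) → (∀ j → f j ≤ 1) →
  (∀ {j k} → j ≢ k → group j ≡ group k → f j + f k ≤ 1) → sumFin r f ≤ ⌈ r /2⌉
sumFin-≤-⌈/2⌉ zero          f ≤1 pair = z≤n
sumFin-≤-⌈/2⌉ (suc zero)    f ≤1 pair = ≤-trans (≤-reflexive (+-identityʳ _)) (≤1 zero)
sumFin-≤-⌈/2⌉ (suc (suc r)) f ≤1 pair =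
  ≤-trans (≤-reflexive (sym (+-assoc (f zero) (f (suc zero)) _)))
    (+-mono-≤ (pair (λ ()) refl)
      (sumFin-≤-⌈/2⌉ r (f ∘ suc₂) (≤1 ∘ suc₂)
        λ j≢k g → pair (j≢k ∘ suc-injective ∘ suc-injective) (cong suc g)))

module PairedColouring {r : ℕ} (n : Fin r → ℕ) where

  blockIndex : (i : Fin r) → Fin (n i) → ℕ
  blockIndex i a = offset n i + toℕ a

  colour : Vtx r n → Vtx r n → ℕ
  colour (i , a) (j , b) with group i ≟ group j
  ... | yes _ = toℕ a + toℕ b
  ... | no  _ = blockIndex i a + blockIndex j b

  colour-sameGroup : ∀ {i j} a b → group i ≡ group j → colour (i , a) (j , b) ≡ toℕ a + toℕ b
  colour-sameGroup {i} {j} a b g with group i ≟ group j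
  ... | yes _ = refl
  ... | no  g̸ = ⊥-elim (g̸ g)

  colour-otherGroup : ∀ {i j} a b → group i ≢ group j →
    colour (i , a) (j , b) ≡ blockIndex i a + blockIndex j b
  colour-otherGroup {i} {j} a b g̸ with group i ≟ group j
  ... | yes g = ⊥-elim (g̸ g)
  ... | no  _ = refl

  colour-sym : ∀ u v → colour u v ≡ colour v u
  colour-sym (i , a) (j , b) with group i ≟ group j
  ... | yes g = trans (+-comm (toℕ a) (toℕ b)) (sym (colour-sameGroup b a (sym g)))
  ... | no  g̸ = trans (+-comm (blockIndex i a) (blockIndex j b)) (sym (colour-otherGroup b a (g̸ ∘ sym)))

  colouring : EdgeColoring r n
  colouring = record { col = colour ; col-sym = λ {u} {v} _ → colour-sym u v }

  colour-injectiveʳ : ∀ {u j} {b b′ : Fin (n j)} → colour u (j , b) ≡ colour u (j , b′) → b ≡ b′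
  colour-injectiveʳ {i , a} {j} eq with group i ≟ group j
  ... | yes _ = toℕ-injective (+-cancelˡ-≡ (toℕ a) _ _ eq)
  ... | no  _ = toℕ-injective (+-cancelˡ-≡ (offset n j) _ _ (+-cancelˡ-≡ (blockIndex i a) _ _ eq))

  colour-distinct-in-group : ∀ {u j k} {b : Fin (n j)} {b′ : Fin (n k)} → j ≢ k → group j ≡ group k →
    Adj r n u (j , b) → Adj r n u (k , b′) → colour u (j , b) ≢ colour u (k , b′)
  colour-distinct-in-group {i , a} {j} {k} {b} {b′} j≢k g i≢j i≢k eq with group i ≟ group j
  ... | yes gij with group-≤2 j≢k g gij
  ...   | inj₁ i≡j = i≢j i≡j
  ...   | inj₂ i≡k = i≢k i≡k
  colour-distinct-in-group {i , a} {j} {k} {b} {b′} j≢k g i≢j i≢k eq | no gij =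
    offset-disjoint n j≢k g (toℕ<n b) (toℕ<n b′)
      (+-cancelˡ-≡ (blockIndex i a) _ _
        (trans eq (colour-otherGroup a b′ λ gik → gij (trans gik (sym g)))))

  improper : IsKImproper r n ⌈ r /2⌉ colouring
  improper u x = sumFin-≤-⌈/2⌉ r (λ j → count (n j) (P? j)) atMostOne exclusive
    where
      P? : ∀ j (b : Fin (n j)) → Dec (Adj r n u (j , b) × colour u (j , b) ≡ x)
      P? j b = adj? r n u (j , b) ×-dec (colour u (j , b) ≟ x)

      atMostOne : ∀ j → count (n j) (P? j) ≤ 1
      atMostOne j = count-≤1 (n j) (P? j) λ (_ , p) (_ , q) → colour-injectiveʳ {u} (trans p (sym q))

      exclusive : ∀ {j k} → j ≢ k → group j ≡ group k → count (n j) (P? j) + count (n k) (P? k) ≤ 1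
      exclusive {j} {k} j≢k g = exclusive-+≤1 (atMostOne j) (atMostOne k) λ pos pos′ →
        let (_ , adj , p) = count-witness (n j) (P? j) pos
            (_ , adj′ , q) = count-witness (n k) (P? k) pos′
        in colour-distinct-in-group {u} j≢k g adj adj′ (trans p (sym q))

  Colour : Vtx r n → ℕ → Set
  Colour = ColorAt r n colouring

  colour-≥ : ∀ {i a c} → Colour (i , a) c → toℕ a ≤ c
  colour-≥ {i} {a} ((j , b) , _ , refl) with group i ≟ group j
  ... | yes _ = m≤m+n _ _
  ... | no  _ = ≤-trans (m≤n+m (toℕ a) (offset n i)) (m≤m+n _ _)

  colour-ownGroup : ∀ {i a j y} → j ≢ i → group j ≡ group i → y < n j → Colour (i , a) (toℕ a + y)
  colour-ownGroup {i} {a} {j} {y} j≢i g y<n =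
    (j , fromℕ< y<n) , j≢i ∘ sym ,
    trans (colour-sameGroup a _ (sym g)) (cong (toℕ a +_) (toℕ-fromℕ< y<n))

  colour-otherBlock : ∀ {i a j y} → group i ≢ group j → y < offset n j + n j →
    Colour (i , a) (blockIndex i a + y)
  colour-otherBlock {i} {a} {j} {y} g̸ y< with offset-cover n j y<
  ... | k , gkj , o≤y , y<o = (k , fromℕ< z<n) , i≢k , colour≡
    where
      z<n : y ∸ offset n k < n k
      z<n = +-cancelˡ-< (offset n k) _ _ (subst (_< offset n k + n k) (sym (m+[n∸m]≡n o≤y)) y<o)
      i≢k : i ≢ k
      i≢k i≡k = g̸ (trans (cong group i≡k) gkj)
      colour≡ : colour (i , a) (k , fromℕ< z<n) ≡ blockIndex i a + y
      colour≡ = begin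
        colour (i , a) (k , fromℕ< z<n)                     ≡⟨ colour-otherGroup a _ (g̸ ∘ λ gik → trans gik gkj) ⟩
        blockIndex i a + (offset n k + toℕ (fromℕ< z<n))    ≡⟨ cong (λ t → blockIndex i a + (offset n k + t)) (toℕ-fromℕ< z<n) ⟩
        blockIndex i a + (offset n k + (y ∸ offset n k))    ≡⟨ cong (blockIndex i a +_) (m+[n∸m]≡n o≤y) ⟩
        blockIndex i a + y                                  ∎
        where open ≡-Reasoning

  colour-downward : ∀ {i a c x} → Colour (i , a) c → toℕ a ≤ x → x ≤ c → Colour (i , a) x
  colour-downward {i} {a} {x = x} ((j , b) , i≢j , refl) a≤x x≤c with group i ≟ group j
  ... | yes g =
    subst (Colour _) (m+[n∸m]≡n a≤x)
      (colour-ownGroup (i≢j ∘ sym) (sym g) (≤-<-trans (m≤n+o⇒m∸n≤o x (toℕ a) x≤c) (toℕ<n b)))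
  ... | no g̸ with blockIndex i a ≤? x
  ...   | yes block≤x =
    subst (Colour _) (m+[n∸m]≡n block≤x)
      (colour-otherBlock g̸
        (≤-<-trans (m≤n+o⇒m∸n≤o x (blockIndex i a) x≤c) (+-monoʳ-< (offset n j) (toℕ<n b))))
  ...   | no  block≰x with below-offset-partner n i x∸a<offset
    where
      x∸a<offset : x ∸ toℕ a < offset n i
      x∸a<offset = subst (x ∸ toℕ a <_) (m+n∸n≡m (offset n i) (toℕ a)) (∸-monoˡ-< (≰⇒> block≰x) a≤x)
  ...     | k , k≢i , g , y<n = subst (Colour _) (m+[n∸m]≡n a≤x) (colour-ownGroup k≢i g y<n)

  interval : IsInterval r n colouring
  interval v c d x cv dv c≤x x≤d = colour-downward dv (≤-trans (colour-≥ cv) c≤x) x≤d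

theorem30 : (r : ℕ) → 2 ≤ r → (n : Fin r → ℕ) → (∀ i → 0 < n i) →
    μint≤ r n ⌈ r /2⌉
theorem30 r _ n _ = ⌈ r /2⌉ , ≤-refl , colouring , improper , interval
  where open PairedColouring n
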